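{- Let $G$ be a finite unweighted digraph without loops having a reciprocal leaf $i$, and let $\widetilde G$ be obtained from $G$ by removing $i$ together with the reciprocal edge connecting $i$ to the rest of $G$. Let $M(t)$ and $\widetilde M(t)$ be the directed deformed graph Laplacians of $G$ and $\widetilde G$. Then $M(t)$ and $\widetilde M(t)$ have the same finite eigenvalues, with the same algebraic and geometric multiplicities.
   Context: For a digraph with adjacency matrix $A$, its directed deformed graph Laplacian is $M(t)=I-At+(D-I)t^2+(A-S)t^3$ with $S=A\circ A^T$ and $D=\mathrm{diag}(\mathrm{diag}(A^2))$. A vertex $i$ is a reciprocal leaf if it is adjacent to exactly one other vertex $j$ and both $(i,j)$ and $(j,i)$ are edges (and there are no other edges into or out of $i$). A finite eigenvalue $\lambda$ of $M(t)$ is a root of $\det M(t)$; its algebraic multiplicity is its multiplicity as such a root and its geometric multiplicity is $\dim\ker M(\lambda)$. -}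

module Defs where

open import Level using (Level; _⊔_)
open import Algebra.Bundles using (CommutativeRing)
open import Data.Bool using (Bool; true; false; _∧_; if_then_else_)
open import Data.Nat using (ℕ; zero; suc)
open import Data.Fin using (Fin; zero; suc; toℕ; punchIn; _≟_)
open import Data.List using (List; []; _∷_; map)
open import Data.Product using (Σ; ∃; _×_; _,_)
open import Data.Unit using (⊤)
open import Relation.Nullary using (¬_; does)
open import Relation.Binary.PropositionalEquality using (_≡_; _≢_)

record IsField {c ℓ} (K : CommutativeRing c ℓ) : Set (c ⊔ ℓ) where
  open CommutativeRing K
  field
    1≉0     : ¬ (1# ≈ 0#)
    inverse : ∀ x → ¬ (x ≈ 0#) → Σ Carrier λ y → (x * y) ≈ 1#

Adj : ℕ → Set
Adj n = Fin n → Fin n → Bool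

Loopless : ∀ {n} → Adj n → Set
Loopless A = ∀ v → A v v ≡ false

ReciprocalLeaf : ∀ {n} → Adj n → Fin n → Set
ReciprocalLeaf A i =
  Σ _ λ j → (j ≢ i) × (A i j ≡ true) × (A j i ≡ true)
          × (∀ k → k ≢ j → (A i k ≡ false) × (A k i ≡ false))

removeVertex : ∀ {n} → Adj (suc n) → Fin (suc n) → Adj n
removeVertex A i a b = A (punchIn i a) (punchIn i b)

module Laplacian {c ℓ} (K : CommutativeRing c ℓ) where
  open CommutativeRing K using (Carrier; _≈_; _+_; _*_; -_; _-_; 0#; 1#)

  sumFin : ∀ n → (Fin n → Carrier) → Carrier
  sumFin zero    f = 0#
  sumFin (suc n) f = f zero + sumFin n (λ k → f (suc k))

  -- Polynomials in t over K: coefficient lists, lowest degree first.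

  Poly : Set c
  Poly = List Carrier

  _+ₚ_ : Poly → Poly → Poly
  []      +ₚ q       = q
  (a ∷ p) +ₚ []      = a ∷ p
  (a ∷ p) +ₚ (b ∷ q) = (a + b) ∷ (p +ₚ q)

  _*ₚ_ : Poly → Poly → Poly
  []      *ₚ q = []
  (a ∷ p) *ₚ q = map (a *_) q +ₚ (0# ∷ (p *ₚ q))

  -ₚ_ : Poly → Poly
  -ₚ p = map -_ p

  0ₚ 1ₚ : Poly
  0ₚ = []
  1ₚ = 1# ∷ []

  -- equality of polynomials (coefficientwise, up to trailing zeros)
  _≈ₚ_ : Poly → Poly → Set ℓ
  []      ≈ₚ []      = Level.Lift ℓ ⊤
  []      ≈ₚ (b ∷ q) = (b ≈ 0#) × ([] ≈ₚ q)
  (a ∷ p) ≈ₚ []      = (a ≈ 0#) × (p ≈ₚ [])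
  (a ∷ p) ≈ₚ (b ∷ q) = (a ≈ b) × (p ≈ₚ q)

  _∣ₚ_ : Poly → Poly → Set (c ⊔ ℓ)
  p ∣ₚ q = Σ Poly λ r → (p *ₚ r) ≈ₚ q

  _^ₚ_ : Poly → ℕ → Poly
  p ^ₚ zero  = 1ₚ
  p ^ₚ suc m = p *ₚ (p ^ₚ m)

  t-_ : Carrier → Poly
  t- x = (- x) ∷ 1# ∷ []

  eval : Poly → Carrier → Carrier
  eval []      x = 0#
  eval (a ∷ p) x = a + x * eval p x

  record RingOps {a} (S : Set a) : Set a where
    field
      o0 o1 : S
      oadd omul : S → S → S
      oneg : S → S

  module _ {a} {S : Set a} (o : RingOps S) where
    open RingOps o

    sumOps : ∀ n → (Fin n → S) → S
    sumOps zero    f = o0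
    sumOps (suc n) f = oadd (f zero) (sumOps n (λ k → f (suc k)))

    signed : ℕ → S → S
    signed zero    s = s
    signed (suc k) s = oneg (signed k s)

    det : ∀ n → (Fin n → Fin n → S) → S
    det zero    M = o1
    det (suc n) M =
      sumOps (suc n) λ j →
        signed (toℕ j) (omul (M zero j) (det n (λ a b → M (suc a) (punchIn j b))))

  polyOps : RingOps Poly
  polyOps = record { o0 = 0ₚ ; o1 = 1ₚ ; oadd = _+ₚ_ ; omul = _*ₚ_ ; oneg = -ₚ_ }

  scalarOps : RingOps Carrier
  scalarOps = record { o0 = 0# ; o1 = 1# ; oadd = _+_ ; omul = _*_ ; oneg = -_ }

  -- The directed deformed graph Laplacian
  --   M(t) = I - A t + (D - I) t² + (A - S) t³,
  -- S = A ∘ Aᵀ, D = diag(diag(A²)).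

  ⟦_⟧ : Bool → Carrier
  ⟦ true  ⟧ = 1#
  ⟦ false ⟧ = 0#

  module _ {n : ℕ} (A : Adj n) where
    δ : Fin n → Fin n → Carrier
    δ a b = ⟦ does (a ≟ b) ⟧

    Smat : Fin n → Fin n → Carrier
    Smat a b = ⟦ A a b ∧ A b a ⟧

    Dmat : Fin n → Fin n → Carrier
    Dmat a b = if does (a ≟ b) then sumFin n (λ k → ⟦ A a k ∧ A k a ⟧) else 0#

    deformedLaplacian : Fin n → Fin n → Poly
    deformedLaplacian a b =
        δ a b
      ∷ (- ⟦ A a b ⟧)
      ∷ (Dmat a b - δ a b)
      ∷ (⟦ A a b ⟧ - Smat a b)
      ∷ []

    charPoly : Poly
    charPoly = det polyOps n deformedLaplacian

    evalLaplacian : Carrier → Fin n → Fin n → Carrier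
    evalLaplacian x a b = eval (deformedLaplacian a b) x

    IsFiniteEigenvalue : Carrier → Set ℓ
    IsFiniteEigenvalue x = eval charPoly x ≈ 0#

    AlgMult : Carrier → ℕ → Set (c ⊔ ℓ)
    AlgMult x m = (((t- x) ^ₚ m) ∣ₚ charPoly) × ¬ (((t- x) ^ₚ suc m) ∣ₚ charPoly)

    IndepKernelFamily : Carrier → ℕ → Set (c ⊔ ℓ)
    IndepKernelFamily x m =
      Σ (Fin m → Fin n → Carrier) λ v →
          (∀ k a → sumFin n (λ b → evalLaplacian x a b * v k b) ≈ 0#)
        × (∀ (γ : Fin m → Carrier) →
             (∀ b → sumFin m (λ k → γ k * v k b) ≈ 0#) → ∀ k → γ k ≈ 0#)

    GeomMult : Carrier → ℕ → Set (c ⊔ ℓ)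
    GeomMult x m = IndepKernelFamily x m × ¬ IndepKernelFamily x (suc m)

-- At a reciprocal leaf i with neighbour j, row and column i of M(t) vanish except for
-- M_ii = 1 (i has no loop and reciprocal degree 1) and M_ij = M_ji = -t (the reciprocal
-- edge cancels in A - S).  Eliminating the unit pivot M_ii leaves the minor of M(t) at i
-- with only its (j, j) entry changed, by -M_ij M_ji = -t²; since j loses exactly one
-- reciprocal neighbour, this Schur complement is the deformed Laplacian of G with i
-- removed.  Hence det M(t) = det M̃(t) in K[t], which gives the same eigenvalues and
-- algebraic multiplicities, and for each x the restriction v ↦ v∘punchIn i is a linear
-- isomorphism ker M(x) ≅ ker M̃(x), inverted by putting v_i = -M_ij(x) v_j = x v_j.
-- Nothing here needs inverses, so the argument works over any commutative ring.
module Submission where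

open import Defs
open import Algebra.Bundles using (CommutativeRing)
open import Data.Nat using (ℕ; suc)
open import Data.Fin using (Fin)
open import Data.Product using (_×_)
open import Function.Bundles using (_⇔_)

open import Data.Bool using (true; false; _∧_)
open import Data.Bool.Properties using (∧-zeroʳ)
open import Data.Empty using (⊥-elim)
open import Data.Fin using (zero; suc; toℕ; punchIn; punchOut; _≟_)
open import Data.Fin.Properties
  using (¬Fin0; suc-injective; punchInᵢ≢i; punchIn-injective; punchIn-punchOut)
open import Data.List using ([]; _∷_; map)
open import Data.Nat as ℕ using (zero)
open import Data.Nat.Properties using (+-suc)
open import Data.Nat.Tactic.RingSolver using (solve-∀)
open import Data.Product using (Σ; _,_; proj₁; proj₂)
open import Data.Vec.Functional using (updateAt)
open import Data.Vec.Functional.Properties using (updateAt-updates; updateAt-minimal)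
open import Function using (_∘_)
open import Function.Bundles using (mk⇔; Equivalence)
open import Function.Construct.Composition using (_⇔-∘_)
open import Function.Construct.Symmetry using (⇔-sym)
open import Level using (_⊔_; lift)
open import Relation.Binary.PropositionalEquality as ≡ using (_≡_; _≢_; cong)
open import Relation.Nullary using (yes; no; does)
open import Relation.Nullary.Decidable using (dec-true; dec-false)

module RingProperties {c ℓ} (R : CommutativeRing c ℓ) where
  open CommutativeRing R public hiding (zero)
  open import Algebra.Properties.Ring ring public
  open import Algebra.Properties.CommutativeSemigroup +-commutativeSemigroup public
    using () renaming (interchange to +-interchange; x∙yz≈y∙xz to +-leftComm)
  open import Algebra.Properties.CommutativeSemigroup *-commutativeSemigroup public
    using () renaming (x∙yz≈y∙xz to *-leftComm)
  open import Relation.Binary.Reasoning.Setoid setoid public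

  +-pres-≈0 : ∀ {x y} → x ≈ 0# → y ≈ 0# → x + y ≈ 0#
  +-pres-≈0 x≈0 y≈0 = trans (+-cong x≈0 y≈0) (+-identityˡ 0#)

  x+[y+z]≈[y-w+z]+[x+w] : ∀ x y z w → x + (y + z) ≈ ((y - w) + z) + (x + w)
  x+[y+z]≈[y-w+z]+[x+w] x y z w = sym (begin
    ((y - w) + z) + (x + w) ≈⟨ +-comm _ _ ⟩
    (x + w) + ((y - w) + z) ≈⟨ +-assoc x w _ ⟩
    x + (w + ((y - w) + z)) ≈⟨ +-congˡ (sym (+-assoc w _ z)) ⟩
    x + ((w + (y - w)) + z) ≈⟨ +-congˡ (+-congʳ w+[y-w]≈y) ⟩
    x + (y + z)             ∎)
    where
    w+[y-w]≈y : w + (y - w) ≈ y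
    w+[y-w]≈y = trans (+-leftComm w y (- w)) (trans (+-congˡ (-‿inverseʳ w)) (+-identityʳ y))

  -x*-y≈x*y : ∀ x y → - x * - y ≈ x * y
  -x*-y≈x*y x y = trans (sym (-‿distribˡ-* x (- y)))
    (trans (-‿cong (sym (-‿distribʳ-* x y))) (-‿involutive _))

module PolynomialRing {c ℓ} (K : CommutativeRing c ℓ) where
  open Laplacian K
  open RingProperties K

  coeff : Poly → ℕ → Carrier
  coeff []      n       = 0#
  coeff (a ∷ p) zero    = a
  coeff (a ∷ p) (suc n) = coeff p n

  infix 4 _≋_
  -- A record rather than a function type, so that p and q can be recovered from a proof.
  record _≋_ (p q : Poly) : Set ℓ where
    constructor coeffwise
    field coeff-≈ : ∀ n → coeff p n ≈ coeff q n
  open _≋_ public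

  ≈ₚ⇒≋ : ∀ p q → p ≈ₚ q → p ≋ q
  ≈ₚ⇒≋ p q e = coeffwise (go p q e)
    where
    go : ∀ p q → p ≈ₚ q → ∀ n → coeff p n ≈ coeff q n
    go []      []      _         n       = refl
    go []      (b ∷ q) (b≈0 , e) zero    = sym b≈0
    go []      (b ∷ q) (b≈0 , e) (suc n) = go [] q e n
    go (a ∷ p) []      (a≈0 , e) zero    = a≈0
    go (a ∷ p) []      (a≈0 , e) (suc n) = go p [] e n
    go (a ∷ p) (b ∷ q) (a≈b , e) zero    = a≈b
    go (a ∷ p) (b ∷ q) (a≈b , e) (suc n) = go p q e n

  ≋⇒≈ₚ : ∀ p q → p ≋ q → p ≈ₚ q
  ≋⇒≈ₚ p q (coeffwise e) = go p q e
    where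
    go : ∀ p q → (∀ n → coeff p n ≈ coeff q n) → p ≈ₚ q
    go []      []      e = lift _
    go []      (b ∷ q) e = sym (e zero) , go [] q (λ n → e (suc n))
    go (a ∷ p) []      e = e zero , go p [] (λ n → e (suc n))
    go (a ∷ p) (b ∷ q) e = e zero , go p q (λ n → e (suc n))

  ≋-refl : ∀ {p} → p ≋ p
  ≋-refl = coeffwise λ _ → refl

  ≋-sym : ∀ {p q} → p ≋ q → q ≋ p
  ≋-sym e = coeffwise λ n → sym (coeff-≈ e n)

  ≋-trans : ∀ {p q r} → p ≋ q → q ≋ r → p ≋ r
  ≋-trans e f = coeffwise λ n → trans (coeff-≈ e n) (coeff-≈ f n)

  ≈ₚ-sym : ∀ p q → p ≈ₚ q → q ≈ₚ p
  ≈ₚ-sym p q e = ≋⇒≈ₚ q p (≋-sym (≈ₚ⇒≋ p q e))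

  ≈ₚ-trans : ∀ p q r → p ≈ₚ q → q ≈ₚ r → p ≈ₚ r
  ≈ₚ-trans p q r e f = ≋⇒≈ₚ p r (≋-trans (≈ₚ⇒≋ p q e) (≈ₚ⇒≋ q r f))

  ∣ₚ-respʳ : ∀ p {q q′} → q ≈ₚ q′ → p ∣ₚ q → p ∣ₚ q′
  ∣ₚ-respʳ p {q} {q′} q≈q′ (r , pr≈q) = r , ≈ₚ-trans (p *ₚ r) q q′ pr≈q q≈q′

  coeff-+ₚ : ∀ p q n → coeff (p +ₚ q) n ≈ coeff p n + coeff q n
  coeff-+ₚ []      q       n       = sym (+-identityˡ _)
  coeff-+ₚ (a ∷ p) []      n       = sym (+-identityʳ _)
  coeff-+ₚ (a ∷ p) (b ∷ q) zero    = refl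
  coeff-+ₚ (a ∷ p) (b ∷ q) (suc n) = coeff-+ₚ p q n

  coeff-map : ∀ f → f 0# ≈ 0# → ∀ p n → coeff (map f p) n ≈ f (coeff p n)
  coeff-map f f0≈0 []      n       = sym f0≈0
  coeff-map f f0≈0 (a ∷ p) zero    = refl
  coeff-map f f0≈0 (a ∷ p) (suc n) = coeff-map f f0≈0 p n

  coeff--ₚ : ∀ p n → coeff (-ₚ p) n ≈ - coeff p n
  coeff--ₚ = coeff-map -_ -0#≈0#

  coeff-scale : ∀ a p n → coeff (map (a *_) p) n ≈ a * coeff p n
  coeff-scale a = coeff-map (a *_) (zeroʳ a)

  coeff-*ₚ : ∀ a p q n → coeff ((a ∷ p) *ₚ q) n ≈ a * coeff q n + coeff (0# ∷ (p *ₚ q)) n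
  coeff-*ₚ a p q n = trans (coeff-+ₚ (map (a *_) q) (0# ∷ (p *ₚ q)) n) (+-congʳ (coeff-scale a q n))

  0∷-cong : ∀ {p q} → p ≋ q → (0# ∷ p) ≋ (0# ∷ q)
  0∷-cong e = coeffwise λ { zero → refl ; (suc n) → coeff-≈ e n }

  0∷0ₚ : (0# ∷ 0ₚ) ≋ 0ₚ
  0∷0ₚ = coeffwise λ { zero → refl ; (suc n) → refl }

  0∷-scale : ∀ a p → (0# ∷ map (a *_) p) ≋ map (a *_) (0# ∷ p)
  0∷-scale a p = coeffwise λ { zero → sym (zeroʳ a) ; (suc n) → refl }

  0∷-+ₚ : ∀ p q → (0# ∷ (p +ₚ q)) ≋ ((0# ∷ p) +ₚ (0# ∷ q))
  0∷-+ₚ p q = coeffwise λ { zero → sym (+-identityˡ 0#) ; (suc n) → refl }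

  +ₚ-cong : ∀ {p p′ q q′} → p ≋ p′ → q ≋ q′ → (p +ₚ q) ≋ (p′ +ₚ q′)
  +ₚ-cong {p} {p′} {q} {q′} e f = coeffwise λ n →
    trans (coeff-+ₚ p q n) (trans (+-cong (coeff-≈ e n) (coeff-≈ f n)) (sym (coeff-+ₚ p′ q′ n)))

  +ₚ-assoc : ∀ p q r → ((p +ₚ q) +ₚ r) ≋ (p +ₚ (q +ₚ r))
  +ₚ-assoc p q r = coeffwise λ n → begin
    coeff ((p +ₚ q) +ₚ r) n             ≈⟨ trans (coeff-+ₚ (p +ₚ q) r n) (+-congʳ (coeff-+ₚ p q n)) ⟩
    (coeff p n + coeff q n) + coeff r n ≈⟨ +-assoc _ _ _ ⟩
    coeff p n + (coeff q n + coeff r n) ≈⟨ sym (trans (coeff-+ₚ p (q +ₚ r) n) (+-congˡ (coeff-+ₚ q r n))) ⟩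
    coeff (p +ₚ (q +ₚ r)) n             ∎

  +ₚ-comm : ∀ p q → (p +ₚ q) ≋ (q +ₚ p)
  +ₚ-comm p q = coeffwise λ n → trans (coeff-+ₚ p q n) (trans (+-comm _ _) (sym (coeff-+ₚ q p n)))

  +ₚ-identityʳ : ∀ p → (p +ₚ 0ₚ) ≋ p
  +ₚ-identityʳ p = coeffwise λ n → trans (coeff-+ₚ p [] n) (+-identityʳ _)

  -ₚ-cong : ∀ {p q} → p ≋ q → (-ₚ p) ≋ (-ₚ q)
  -ₚ-cong {p} {q} e = coeffwise λ n →
    trans (coeff--ₚ p n) (trans (-‿cong (coeff-≈ e n)) (sym (coeff--ₚ q n)))

  -ₚ-inverseʳ : ∀ p → (p +ₚ (-ₚ p)) ≋ 0ₚ
  -ₚ-inverseʳ p = coeffwise λ n →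
    trans (coeff-+ₚ p (-ₚ p) n) (trans (+-congˡ (coeff--ₚ p n)) (-‿inverseʳ _))

  -ₚ-inverseˡ : ∀ p → ((-ₚ p) +ₚ p) ≋ 0ₚ
  -ₚ-inverseˡ p = ≋-trans (+ₚ-comm (-ₚ p) p) (-ₚ-inverseʳ p)

  *ₚ-zeroʳ : ∀ p → (p *ₚ 0ₚ) ≋ 0ₚ
  *ₚ-zeroʳ []      = ≋-refl
  *ₚ-zeroʳ (a ∷ p) = coeffwise λ { zero → refl ; (suc n) → coeff-≈ (*ₚ-zeroʳ p) n }

  *ₚ-congʳ : ∀ p {q q′} → q ≋ q′ → (p *ₚ q) ≋ (p *ₚ q′)
  *ₚ-congʳ []      e = ≋-refl
  *ₚ-congʳ (a ∷ p) {q} {q′} e = coeffwise λ n → begin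
    coeff ((a ∷ p) *ₚ q) n                    ≈⟨ coeff-*ₚ a p q n ⟩
    a * coeff q n + coeff (0# ∷ (p *ₚ q)) n
      ≈⟨ +-cong (*-congˡ (coeff-≈ e n)) (coeff-≈ (0∷-cong (*ₚ-congʳ p e)) n) ⟩
    a * coeff q′ n + coeff (0# ∷ (p *ₚ q′)) n
      ≈⟨ sym (coeff-*ₚ a p q′ n) ⟩
    coeff ((a ∷ p) *ₚ q′) n                   ∎

  *ₚ-consʳ : ∀ p b q → (p *ₚ (b ∷ q)) ≋ (map (b *_) p +ₚ (0# ∷ (p *ₚ q)))
  *ₚ-consʳ []      b q = ≋-sym 0∷0ₚ
  *ₚ-consʳ (a ∷ p) b q = coeffwise λ
    { zero    → +-congʳ (*-comm a b)
    ; (suc n) → begin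
        coeff (map (a *_) q +ₚ (p *ₚ (b ∷ q))) n
          ≈⟨ trans (coeff-+ₚ (map (a *_) q) _ n) (+-congˡ (coeff-≈ (*ₚ-consʳ p b q) n)) ⟩
        coeff (map (a *_) q) n + coeff (map (b *_) p +ₚ (0# ∷ (p *ₚ q))) n
          ≈⟨ +-congˡ (coeff-+ₚ (map (b *_) p) _ n) ⟩
        coeff (map (a *_) q) n + (coeff (map (b *_) p) n + coeff (0# ∷ (p *ₚ q)) n)
          ≈⟨ +-leftComm _ _ _ ⟩
        coeff (map (b *_) p) n + (coeff (map (a *_) q) n + coeff (0# ∷ (p *ₚ q)) n)
          ≈⟨ sym (trans (coeff-+ₚ (map (b *_) p) _ n) (+-congˡ (coeff-+ₚ (map (a *_) q) _ n))) ⟩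
        coeff (map (b *_) p +ₚ (map (a *_) q +ₚ (0# ∷ (p *ₚ q)))) n ∎
    }

  *ₚ-comm : ∀ p q → (p *ₚ q) ≋ (q *ₚ p)
  *ₚ-comm []      q = ≋-sym (*ₚ-zeroʳ q)
  *ₚ-comm (a ∷ p) q = ≋-trans (+ₚ-cong ≋-refl (0∷-cong (*ₚ-comm p q))) (≋-sym (*ₚ-consʳ q a p))

  *ₚ-congˡ : ∀ {p p′} q → p ≋ p′ → (p *ₚ q) ≋ (p′ *ₚ q)
  *ₚ-congˡ {p} {p′} q e = ≋-trans (*ₚ-comm p q) (≋-trans (*ₚ-congʳ q e) (*ₚ-comm q p′))

  *ₚ-distribˡ : ∀ p q r → (p *ₚ (q +ₚ r)) ≋ ((p *ₚ q) +ₚ (p *ₚ r))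
  *ₚ-distribˡ []      q r = ≋-refl
  *ₚ-distribˡ (a ∷ p) q r = coeffwise λ n → begin
    coeff ((a ∷ p) *ₚ (q +ₚ r)) n
      ≈⟨ coeff-*ₚ a p (q +ₚ r) n ⟩
    a * coeff (q +ₚ r) n + coeff (0# ∷ (p *ₚ (q +ₚ r))) n
      ≈⟨ +-cong (*-congˡ (coeff-+ₚ q r n))
                (trans (coeff-≈ (≋-trans (0∷-cong (*ₚ-distribˡ p q r)) (0∷-+ₚ (p *ₚ q) (p *ₚ r))) n)
                       (coeff-+ₚ (0# ∷ (p *ₚ q)) (0# ∷ (p *ₚ r)) n)) ⟩
    a * (coeff q n + coeff r n) + (coeff (0# ∷ (p *ₚ q)) n + coeff (0# ∷ (p *ₚ r)) n)
      ≈⟨ trans (+-congʳ (distribˡ a _ _)) (+-interchange _ _ _ _) ⟩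
    (a * coeff q n + coeff (0# ∷ (p *ₚ q)) n) + (a * coeff r n + coeff (0# ∷ (p *ₚ r)) n)
      ≈⟨ sym (trans (coeff-+ₚ ((a ∷ p) *ₚ q) _ n) (+-cong (coeff-*ₚ a p q n) (coeff-*ₚ a p r n))) ⟩
    coeff (((a ∷ p) *ₚ q) +ₚ ((a ∷ p) *ₚ r)) n ∎

  *ₚ-distribʳ : ∀ r p q → ((p +ₚ q) *ₚ r) ≋ ((p *ₚ r) +ₚ (q *ₚ r))
  *ₚ-distribʳ r p q = ≋-trans (*ₚ-comm (p +ₚ q) r)
    (≋-trans (*ₚ-distribˡ r p q) (+ₚ-cong (*ₚ-comm r p) (*ₚ-comm r q)))

  scale-*ₚ : ∀ a q r → (map (a *_) q *ₚ r) ≋ map (a *_) (q *ₚ r)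
  scale-*ₚ a []      r = ≋-refl
  scale-*ₚ a (b ∷ q) r = coeffwise λ n → begin
    coeff ((a * b ∷ map (a *_) q) *ₚ r) n
      ≈⟨ coeff-*ₚ (a * b) (map (a *_) q) r n ⟩
    (a * b) * coeff r n + coeff (0# ∷ (map (a *_) q *ₚ r)) n
      ≈⟨ +-cong (*-assoc a b _)
                (trans (coeff-≈ (≋-trans (0∷-cong (scale-*ₚ a q r)) (0∷-scale a (q *ₚ r))) n)
                       (coeff-scale a (0# ∷ (q *ₚ r)) n)) ⟩
    a * (b * coeff r n) + a * coeff (0# ∷ (q *ₚ r)) n
      ≈⟨ trans (sym (distribˡ a _ _)) (*-congˡ (sym (coeff-*ₚ b q r n))) ⟩
    a * coeff ((b ∷ q) *ₚ r) n
      ≈⟨ sym (coeff-scale a ((b ∷ q) *ₚ r) n) ⟩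
    coeff (map (a *_) ((b ∷ q) *ₚ r)) n ∎

  0∷-*ₚ : ∀ p r → ((0# ∷ p) *ₚ r) ≋ (0# ∷ (p *ₚ r))
  0∷-*ₚ p r = coeffwise λ n → trans (coeff-*ₚ 0# p r n) (trans (+-congʳ (zeroˡ _)) (+-identityˡ _))

  *ₚ-assoc : ∀ p q r → ((p *ₚ q) *ₚ r) ≋ (p *ₚ (q *ₚ r))
  *ₚ-assoc []      q r = ≋-refl
  *ₚ-assoc (a ∷ p) q r = ≋-trans (*ₚ-distribʳ r (map (a *_) q) (0# ∷ (p *ₚ q)))
    (+ₚ-cong (scale-*ₚ a q r) (≋-trans (0∷-*ₚ (p *ₚ q) r) (0∷-cong (*ₚ-assoc p q r))))

  *ₚ-identityˡ : ∀ p → (1ₚ *ₚ p) ≋ p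
  *ₚ-identityˡ p = coeffwise λ n → trans (coeff-*ₚ 1# [] p n)
    (trans (+-cong (*-identityˡ _) (coeff-≈ 0∷0ₚ n)) (+-identityʳ _))

  K[t] : CommutativeRing c ℓ
  K[t] = record
    { Carrier = Poly ; _≈_ = _≋_ ; _+_ = _+ₚ_ ; _*_ = _*ₚ_ ; -_ = -ₚ_ ; 0# = 0ₚ ; 1# = 1ₚ
    ; isCommutativeRing = record
      { isRing = record
        { +-isAbelianGroup = record
          { isGroup = record
            { isMonoid = record
              { isSemigroup = record
                { isMagma = record
                  { isEquivalence = record { refl = ≋-refl ; sym = ≋-sym ; trans = ≋-trans }
                  ; ∙-cong = +ₚ-cong }
                ; assoc = +ₚ-assoc }
              ; identity = (λ _ → ≋-refl) , +ₚ-identityʳ }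
            ; inverse = -ₚ-inverseˡ , -ₚ-inverseʳ
            ; ⁻¹-cong = -ₚ-cong }
          ; comm = +ₚ-comm }
        ; *-cong = λ {p} {p′} {q} {q′} e f → ≋-trans (*ₚ-congˡ q e) (*ₚ-congʳ p′ f)
        ; *-assoc = *ₚ-assoc
        ; *-identity = *ₚ-identityˡ , λ p → ≋-trans (*ₚ-comm p 1ₚ) (*ₚ-identityˡ p)
        ; distrib = *ₚ-distribˡ , *ₚ-distribʳ }
      ; *-comm = *ₚ-comm } }

  eval-cong : ∀ x {p q} → p ≋ q → eval p x ≈ eval q x
  eval-cong x {p} {q} e = go p q (≋⇒≈ₚ p q e)
    where
    go : ∀ p q → p ≈ₚ q → eval p x ≈ eval q x
    go []      []      _         = refl
    go []      (b ∷ q) (b≈0 , e) = sym (+-pres-≈0 b≈0 (trans (*-congˡ (sym (go [] q e))) (zeroʳ x)))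
    go (a ∷ p) []      (a≈0 , e) = +-pres-≈0 a≈0 (trans (*-congˡ (go p [] e)) (zeroʳ x))
    go (a ∷ p) (b ∷ q) (a≈b , e) = +-cong a≈b (*-congˡ (go p q e))

  eval-+ₚ : ∀ x p q → eval (p +ₚ q) x ≈ eval p x + eval q x
  eval-+ₚ x []      q       = sym (+-identityˡ _)
  eval-+ₚ x (a ∷ p) []      = sym (+-identityʳ _)
  eval-+ₚ x (a ∷ p) (b ∷ q) =
    trans (+-congˡ (trans (*-congˡ (eval-+ₚ x p q)) (distribˡ x _ _))) (+-interchange a b _ _)

  eval--ₚ : ∀ x p → eval (-ₚ p) x ≈ - eval p x
  eval--ₚ x []      = sym -0#≈0#
  eval--ₚ x (a ∷ p) =
    trans (+-congˡ (trans (*-congˡ (eval--ₚ x p)) (sym (-‿distribʳ-* x _)))) (-‿+-comm a _)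

  eval-scale : ∀ x a p → eval (map (a *_) p) x ≈ a * eval p x
  eval-scale x a []      = sym (zeroʳ a)
  eval-scale x a (b ∷ p) = begin
    a * b + x * eval (map (a *_) p) x ≈⟨ +-congˡ (trans (*-congˡ (eval-scale x a p)) (*-leftComm x a _)) ⟩
    a * b + a * (x * eval p x)        ≈⟨ sym (distribˡ a b _) ⟩
    a * (b + x * eval p x)            ∎

  eval-*ₚ : ∀ x p q → eval (p *ₚ q) x ≈ eval p x * eval q x
  eval-*ₚ x []      q = sym (zeroˡ _)
  eval-*ₚ x (a ∷ p) q = begin
    eval (map (a *_) q +ₚ (0# ∷ (p *ₚ q))) x       ≈⟨ eval-+ₚ x (map (a *_) q) (0# ∷ (p *ₚ q)) ⟩
    eval (map (a *_) q) x + (0# + x * eval (p *ₚ q) x)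
      ≈⟨ +-cong (eval-scale x a q) (trans (+-identityˡ _) (*-congˡ (eval-*ₚ x p q))) ⟩
    a * eval q x + x * (eval p x * eval q x)       ≈⟨ +-congˡ (sym (*-assoc x _ _)) ⟩
    a * eval q x + (x * eval p x) * eval q x       ≈⟨ sym (distribʳ (eval q x) a _) ⟩
    (a + x * eval p x) * eval q x                  ∎

  eval-1ₚ : ∀ x → eval 1ₚ x ≈ 1#
  eval-1ₚ x = trans (+-congˡ (zeroʳ x)) (+-identityʳ 1#)

punchIn-exchange : ∀ {m} (x y : Fin (suc (suc m))) (x′ y′ : Fin (suc m)) →
  punchIn y x′ ≡ x → punchIn x y′ ≡ y → ∀ b → punchIn x (punchIn y′ b) ≡ punchIn y (punchIn x′ b)
punchIn-exchange zero     (suc y′) zero     y′       ≡.refl ≡.refl b       = ≡.refl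
punchIn-exchange (suc x′) zero     x′       zero     ≡.refl ≡.refl b       = ≡.refl
punchIn-exchange (suc x)  (suc y)  (suc x′) (suc y′) x≡    y≡   zero    = ≡.refl
punchIn-exchange (suc x)  (suc y)  (suc x′) (suc y′) x≡    y≡   (suc b) =
  cong suc (punchIn-exchange x y x′ y′ (suc-injective x≡) (suc-injective y≡) b)

toℕ-punchIn-exchange : ∀ {m} (x y : Fin (suc (suc m))) (x′ y′ : Fin (suc m)) →
  punchIn y x′ ≡ x → punchIn x y′ ≡ y → toℕ x ℕ.+ toℕ y ≡ suc (toℕ x′ ℕ.+ toℕ y′)
toℕ-punchIn-exchange zero     (suc y′) zero     y′       ≡.refl ≡.refl = ≡.refl
toℕ-punchIn-exchange (suc x′) zero     x′       zero     ≡.refl ≡.refl = ≡.refl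
toℕ-punchIn-exchange {suc m} (suc x)  (suc y)  (suc x′) (suc y′) x≡     y≡     = cong suc (begin
  toℕ x ℕ.+ suc (toℕ y)         ≡⟨ +-suc (toℕ x) (toℕ y) ⟩
  suc (toℕ x ℕ.+ toℕ y)
    ≡⟨ cong suc (toℕ-punchIn-exchange x y x′ y′ (suc-injective x≡) (suc-injective y≡)) ⟩
  suc (suc (toℕ x′ ℕ.+ toℕ y′)) ≡⟨ cong suc (+-suc (toℕ x′) (toℕ y′)) ⟨
  suc (toℕ x′ ℕ.+ suc (toℕ y′)) ∎)
  where open ≡.≡-Reasoning

-- Sign bookkeeping for deleting two rows or columns in the two possible orders.
exchange-even : ∀ {j c k c′} r → j ℕ.+ c ≡ suc (k ℕ.+ c′) →
  (j ℕ.+ (r ℕ.+ c′)) ℕ.+ (suc r ℕ.+ c ℕ.+ k) ≡ suc (r ℕ.+ (k ℕ.+ c′)) ℕ.+ suc (r ℕ.+ (k ℕ.+ c′))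
exchange-even {j} {c} {k} {c′} r j+c≡ = ≡.trans (regroup j c k c′ r)
  (≡.trans (cong (ℕ._+ ((k ℕ.+ c′) ℕ.+ suc (r ℕ.+ r))) j+c≡) (double (k ℕ.+ c′) r))
  where
  regroup : ∀ j c k c′ r →
    (j ℕ.+ (r ℕ.+ c′)) ℕ.+ (suc r ℕ.+ c ℕ.+ k) ≡ (j ℕ.+ c) ℕ.+ ((k ℕ.+ c′) ℕ.+ suc (r ℕ.+ r))
  regroup = solve-∀
  double : ∀ u r → suc u ℕ.+ (u ℕ.+ suc (r ℕ.+ r)) ≡ suc (r ℕ.+ u) ℕ.+ suc (r ℕ.+ u)
  double = solve-∀

exchange-odd : ∀ {a} x y → a ≡ suc (x ℕ.+ y) →
  (a ℕ.+ (y ℕ.+ x)) ℕ.+ 1 ≡ suc (x ℕ.+ y) ℕ.+ suc (x ℕ.+ y)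
exchange-odd x y ≡.refl = double x y
  where
  double : ∀ x y → (suc (x ℕ.+ y) ℕ.+ (y ℕ.+ x)) ℕ.+ 1 ≡ suc (x ℕ.+ y) ℕ.+ suc (x ℕ.+ y)
  double = solve-∀

-- K only serves to name the determinant of Defs, which lives in Laplacian K but does not
-- depend on K.
module Determinant {c₀ ℓ₀ c ℓ} (K : CommutativeRing c₀ ℓ₀) (R : CommutativeRing c ℓ) where
  open RingProperties R
  open Laplacian K using (RingOps) renaming (sumOps to sumWith; signed to signedWith; det to detWith)

  ops : RingOps Carrier
  ops = record { o0 = 0# ; o1 = 1# ; oadd = _+_ ; omul = _*_ ; oneg = -_ }

  ∑ : ∀ n → (Fin n → Carrier) → Carrier
  ∑ = sumWith ops

  signed : ℕ → Carrier → Carrier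
  signed = signedWith ops

  Matrix : ℕ → Set c
  Matrix n = Fin n → Fin n → Carrier

  det : ∀ n → Matrix n → Carrier
  det = detWith ops

  minor : ∀ {n} → Matrix (suc n) → Fin (suc n) → Fin (suc n) → Matrix n
  minor M r c a b = M (punchIn r a) (punchIn c b)

  ∑-cong : ∀ n {f g : Fin n → Carrier} → (∀ k → f k ≈ g k) → ∑ n f ≈ ∑ n g
  ∑-cong zero    f≈g = refl
  ∑-cong (suc n) f≈g = +-cong (f≈g zero) (∑-cong n (λ k → f≈g (suc k)))

  ∑-+ : ∀ n (f g : Fin n → Carrier) → ∑ n (λ k → f k + g k) ≈ ∑ n f + ∑ n g
  ∑-+ zero    f g = sym (+-identityˡ 0#)
  ∑-+ (suc n) f g = trans (+-congˡ (∑-+ n (λ k → f (suc k)) (λ k → g (suc k)))) (+-interchange _ _ _ _)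

  ∑-≈0 : ∀ n (f : Fin n → Carrier) → (∀ k → f k ≈ 0#) → ∑ n f ≈ 0#
  ∑-≈0 zero    f f≈0 = refl
  ∑-≈0 (suc n) f f≈0 = +-pres-≈0 (f≈0 zero) (∑-≈0 n (λ k → f (suc k)) (λ k → f≈0 (suc k)))

  *-∑ : ∀ n x (f : Fin n → Carrier) → x * ∑ n f ≈ ∑ n (λ k → x * f k)
  *-∑ zero    x f = zeroʳ x
  *-∑ (suc n) x f = trans (distribˡ x _ _) (+-congˡ (*-∑ n x (λ k → f (suc k))))

  ∑-punchIn : ∀ n (f : Fin (suc n) → Carrier) c → ∑ (suc n) f ≈ f c + ∑ n (λ k → f (punchIn c k))
  ∑-punchIn n       f zero    = refl
  ∑-punchIn (suc n) f (suc c) = trans (+-congˡ (∑-punchIn n (λ k → f (suc k)) c)) (+-leftComm _ _ _)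

  ∑-single : ∀ n (f : Fin (suc n) → Carrier) c → (∀ k → k ≢ c → f k ≈ 0#) → ∑ (suc n) f ≈ f c
  ∑-single n f c f≈0 = trans (∑-punchIn n f c)
    (trans (+-congˡ (∑-≈0 n _ (λ k → f≈0 (punchIn c k) (punchInᵢ≢i c k)))) (+-identityʳ _))

  signed-cong : ∀ k {x y} → x ≈ y → signed k x ≈ signed k y
  signed-cong zero    x≈y = x≈y
  signed-cong (suc k) x≈y = -‿cong (signed-cong k x≈y)

  signed-≈0 : ∀ k {x} → x ≈ 0# → signed k x ≈ 0#
  signed-≈0 zero    x≈0 = x≈0
  signed-≈0 (suc k) x≈0 = trans (-‿cong (signed-≈0 k x≈0)) -0#≈0#

  signed-+ : ∀ k x y → signed k (x + y) ≈ signed k x + signed k y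
  signed-+ zero    x y = refl
  signed-+ (suc k) x y = trans (-‿cong (signed-+ k x y)) (sym (-‿+-comm _ _))

  signed-* : ∀ k x y → signed k (x * y) ≈ x * signed k y
  signed-* zero    x y = refl
  signed-* (suc k) x y = trans (-‿cong (signed-* k x y)) (-‿distribʳ-* x _)

  signed-∑ : ∀ k n (f : Fin n → Carrier) → signed k (∑ n f) ≈ ∑ n (λ j → signed k (f j))
  signed-∑ k zero    f = signed-≈0 k refl
  signed-∑ k (suc n) f = trans (signed-+ k _ _) (+-congˡ (signed-∑ k n (λ j → f (suc j))))

  signed-ℕ+ : ∀ a b x → signed (a ℕ.+ b) x ≡ signed a (signed b x)
  signed-ℕ+ zero    b x = ≡.refl
  signed-ℕ+ (suc a) b x = cong -_ (signed-ℕ+ a b x)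

  signed-double : ∀ d x → signed (d ℕ.+ d) x ≈ x
  signed-double zero    x = refl
  signed-double (suc d) x = begin
    - signed (d ℕ.+ suc d) x     ≡⟨ cong (λ k → - signed k x) (+-suc d d) ⟩
    - (- signed (d ℕ.+ d) x)     ≈⟨ -‿involutive _ ⟩
    signed (d ℕ.+ d) x           ≈⟨ signed-double d x ⟩
    x                            ∎

  signed-even : ∀ a b d x → a ℕ.+ b ≡ d ℕ.+ d → signed a x ≈ signed b x
  signed-even a b d x a+b≡d+d = begin
    signed a x                    ≈⟨ signed-cong a (signed-double b x) ⟨
    signed a (signed (b ℕ.+ b) x) ≡⟨ cong (signed a) (signed-ℕ+ b b x) ⟩
    signed a (signed b (signed b x)) ≡⟨ signed-ℕ+ a b _ ⟨
    signed (a ℕ.+ b) (signed b x) ≡⟨ cong (λ k → signed k (signed b x)) a+b≡d+d ⟩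
    signed (d ℕ.+ d) (signed b x) ≈⟨ signed-double d _ ⟩
    signed b x                    ∎

  signed-*-signed : ∀ a b x y z → signed a (x * signed b (y * z)) ≈ signed (a ℕ.+ b) (x * (y * z))
  signed-*-signed a b x y z = begin
    signed a (x * signed b (y * z)) ≈⟨ signed-cong a (signed-* b x (y * z)) ⟨
    signed a (signed b (x * (y * z))) ≡⟨ signed-ℕ+ a b _ ⟨
    signed (a ℕ.+ b) (x * (y * z)) ∎

  signed-swap : ∀ a b a′ b′ d {x y z} → (a ℕ.+ b) ℕ.+ (a′ ℕ.+ b′) ≡ d ℕ.+ d →
    signed a (x * signed b (y * z)) ≈ signed a′ (y * signed b′ (x * z))
  signed-swap a b a′ b′ d {x} {y} {z} even = begin
    signed a (x * signed b (y * z))    ≈⟨ signed-*-signed a b x y z ⟩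
    signed (a ℕ.+ b) (x * (y * z))     ≈⟨ signed-even (a ℕ.+ b) (a′ ℕ.+ b′) d _ even ⟩
    signed (a′ ℕ.+ b′) (x * (y * z))   ≈⟨ signed-cong (a′ ℕ.+ b′) (*-leftComm x y z) ⟩
    signed (a′ ℕ.+ b′) (y * (x * z))   ≈⟨ signed-*-signed a′ b′ y x z ⟨
    signed a′ (y * signed b′ (x * z))  ∎

  det-cong : ∀ n {M N : Matrix n} → (∀ a b → M a b ≈ N a b) → det n M ≈ det n N
  det-cong zero    M≈N = refl
  det-cong (suc n) M≈N = ∑-cong (suc n) λ j → signed-cong (toℕ j)
    (*-cong (M≈N zero j) (det-cong n (λ a b → M≈N (suc a) (punchIn j b))))

  cofactorTerm : ∀ {n} → Matrix (suc n) → Fin (suc n) → Carrier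
  cofactorTerm {n} M j = signed (toℕ j) (M zero j * det n (minor M zero j))

  det-linear : ∀ n (M N P : Matrix n) r →
    (∀ a b → a ≢ r → N a b ≈ M a b × P a b ≈ M a b) →
    (∀ b → M r b ≈ N r b + P r b) → det n M ≈ det n N + det n P
  det-linear (suc n) M N P zero rows≈ row₀≈ =
    trans (∑-cong (suc n) term≈) (∑-+ (suc n) (cofactorTerm N) (cofactorTerm P))
    where
    term≈ : ∀ j → cofactorTerm M j ≈ cofactorTerm N j + cofactorTerm P j
    term≈ j = trans (signed-cong (toℕ j) (begin
      M zero j * det n (minor M zero j)
        ≈⟨ trans (*-congʳ (row₀≈ j)) (distribʳ _ _ _) ⟩
      N zero j * det n (minor M zero j) + P zero j * det n (minor M zero j)
        ≈⟨ +-cong (*-congˡ (det-cong n λ a b → sym (proj₁ (rows≈ (suc a) (punchIn j b) λ ()))))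
                  (*-congˡ (det-cong n λ a b → sym (proj₂ (rows≈ (suc a) (punchIn j b) λ ())))) ⟩
      N zero j * det n (minor N zero j) + P zero j * det n (minor P zero j) ∎))
      (signed-+ (toℕ j) _ _)
  det-linear (suc n) M N P (suc r) rows≈ row-r≈ =
    trans (∑-cong (suc n) term≈) (∑-+ (suc n) (cofactorTerm N) (cofactorTerm P))
    where
    term≈ : ∀ j → cofactorTerm M j ≈ cofactorTerm N j + cofactorTerm P j
    term≈ j = trans (signed-cong (toℕ j) (begin
      M zero j * det n (minor M zero j)
        ≈⟨ *-congˡ (det-linear n (minor M zero j) (minor N zero j) (minor P zero j) r
             (λ a b a≢r → rows≈ (suc a) (punchIn j b) (λ e → a≢r (suc-injective e)))
             (λ b → row-r≈ (punchIn j b))) ⟩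
      M zero j * (det n (minor N zero j) + det n (minor P zero j))
        ≈⟨ distribˡ _ _ _ ⟩
      M zero j * det n (minor N zero j) + M zero j * det n (minor P zero j)
        ≈⟨ +-cong (*-congʳ (sym (proj₁ (rows≈ zero j λ ())))) (*-congʳ (sym (proj₂ (rows≈ zero j λ ())))) ⟩
      N zero j * det n (minor N zero j) + P zero j * det n (minor P zero j) ∎))
      (signed-+ (toℕ j) _ _)

  det-zeroRow : ∀ n (M : Matrix n) r → (∀ b → M r b ≈ 0#) → det n M ≈ 0#
  det-zeroRow n M r row≈0 = x+x≈x⇒x≈0 (det n M) (sym (det-linear n M M M r (λ _ _ _ → refl , refl)
    (λ b → trans (row≈0 b) (sym (+-pres-≈0 (row≈0 b) (row≈0 b))))))

  private
    -- Expanding along row 0 and then each minor along row r produces the same products as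
    -- expanding along row r + 1 and then along row 0.
    expandAlongSucRow : ∀ m (M : Matrix (suc (suc m))) r c →
      cofactorTerm M c ≈ 0# →
      (∀ k c′ → punchIn (punchIn c k) c′ ≡ c →
         det (suc m) (minor M zero (punchIn c k))
           ≈ signed (toℕ r ℕ.+ toℕ c′) (M (suc r) c * det m (minor (minor M zero (punchIn c k)) r c′))) →
      det (suc (suc m)) M ≈ signed (toℕ (suc r) ℕ.+ toℕ c) (M (suc r) c * det (suc m) (minor M (suc r) c))
    expandAlongSucRow m M r c term-c≈0 expandMinor = begin
      det (suc (suc m)) M
        ≈⟨ ∑-punchIn (suc m) (cofactorTerm M) c ⟩
      cofactorTerm M c + ∑ (suc m) (λ k → cofactorTerm M (punchIn c k))
        ≈⟨ trans (+-congʳ term-c≈0) (+-identityˡ _) ⟩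
      ∑ (suc m) (λ k → cofactorTerm M (punchIn c k))
        ≈⟨ ∑-cong (suc m) term≈ ⟩
      ∑ (suc m) (λ k → signed s (M (suc r) c * cofactorTerm M′ k))
        ≈⟨ signed-∑ s (suc m) (λ k → M (suc r) c * cofactorTerm M′ k) ⟨
      signed s (∑ (suc m) (λ k → M (suc r) c * cofactorTerm M′ k))
        ≈⟨ signed-cong s (*-∑ (suc m) (M (suc r) c) (cofactorTerm M′)) ⟨
      signed s (M (suc r) c * det (suc m) M′) ∎
      where
      s = toℕ (suc r) ℕ.+ toℕ c
      M′ = minor M (suc r) c
      term≈ : ∀ k → cofactorTerm M (punchIn c k) ≈ signed s (M (suc r) c * cofactorTerm M′ k)
      term≈ k = begin
        signed (toℕ j) (M zero j * det (suc m) (minor M zero j))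
          ≈⟨ signed-cong (toℕ j) (*-congˡ (trans (expandMinor k c′ j↦c)
               (signed-cong (toℕ r ℕ.+ toℕ c′) (*-congˡ (det-cong m minors≈))))) ⟩
        signed (toℕ j) (M zero j * signed (toℕ r ℕ.+ toℕ c′) (M (suc r) c * det m (minor M′ zero k)))
          ≈⟨ signed-swap (toℕ j) (toℕ r ℕ.+ toℕ c′) s (toℕ k) (suc (toℕ r ℕ.+ (toℕ k ℕ.+ toℕ c′)))
               (exchange-even (toℕ r) (toℕ-punchIn-exchange j c k c′ ≡.refl j↦c)) ⟩
        signed s (M (suc r) c * signed (toℕ k) (M zero j * det m (minor M′ zero k))) ∎
        where
        j = punchIn c k
        c′ = punchOut (punchInᵢ≢i c k)
        j↦c : punchIn j c′ ≡ c
        j↦c = punchIn-punchOut (punchInᵢ≢i c k)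
        minors≈ : ∀ a b → minor (minor M zero j) r c′ a b ≈ minor M′ zero k a b
        minors≈ a b = reflexive (cong (M (suc (punchIn r a))) (punchIn-exchange j c k c′ ≡.refl j↦c b))

  det-expandRow : ∀ n (M : Matrix (suc n)) r c → (∀ b → b ≢ c → M r b ≈ 0#) →
    det (suc n) M ≈ signed (toℕ r ℕ.+ toℕ c) (M r c * det n (minor M r c))
  det-expandRow zero    M zero    zero _     = +-identityʳ _
  det-expandRow (suc m) M zero    c    row≈0 = ∑-single (suc m) (cofactorTerm M) c λ j j≢c →
    signed-≈0 (toℕ j) (trans (*-congʳ (row≈0 j j≢c)) (zeroˡ _))
  det-expandRow (suc m) M (suc r) c    row≈0 = expandAlongSucRow m M r c
    (signed-≈0 (toℕ c) (trans (*-congˡ (det-zeroRow (suc m) (minor M zero c) r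
      (λ b → row≈0 (punchIn c b) (punchInᵢ≢i c b)))) (zeroʳ _)))
    (λ k c′ j↦c → trans (det-expandRow m (minor M zero (punchIn c k)) r c′
        (λ b b≢c′ → row≈0 (punchIn (punchIn c k) b)
          (λ e → b≢c′ (punchIn-injective (punchIn c k) b c′ (≡.trans e (≡.sym j↦c))))))
      (signed-cong (toℕ r ℕ.+ toℕ c′) (*-congʳ (reflexive (cong (M (suc r)) j↦c)))))

  det-expandCol : ∀ n (M : Matrix (suc n)) r c → (∀ a → a ≢ r → M a c ≈ 0#) →
    det (suc n) M ≈ signed (toℕ r ℕ.+ toℕ c) (M r c * det n (minor M r c))
  det-expandCol zero    M zero    zero _     = +-identityʳ _
  det-expandCol (suc m) M zero    c    col≈0 = ∑-single (suc m) (cofactorTerm M) c λ j j≢c →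
    signed-≈0 (toℕ j) (trans (*-congˡ (minor-det≈0 j j≢c)) (zeroʳ _))
    where
    minor-det≈0 : ∀ j → j ≢ c → det (suc m) (minor M zero j) ≈ 0#
    minor-det≈0 j j≢c = trans (det-expandCol m (minor M zero j) zero c′ (λ a _ → column≈0 a))
      (signed-≈0 (toℕ c′) (trans (*-congʳ (column≈0 zero)) (zeroˡ _)))
      where
      c′ = punchOut j≢c
      column≈0 : ∀ a → minor M zero j a c′ ≈ 0#
      column≈0 a = trans (reflexive (cong (M (suc a)) (punchIn-punchOut j≢c))) (col≈0 (suc a) λ ())
  det-expandCol (suc m) M (suc r) c    col≈0 = expandAlongSucRow m M r c
    (signed-≈0 (toℕ c) (trans (*-congʳ (col≈0 zero λ ())) (zeroˡ _)))
    (λ k c′ j↦c → trans (det-expandCol m (minor M zero (punchIn c k)) r c′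
        (λ a a≢r → trans (reflexive (cong (M (suc a)) j↦c)) (col≈0 (suc a) (λ e → a≢r (suc-injective e)))))
      (signed-cong (toℕ r ℕ.+ toℕ c′) (*-congʳ (reflexive (cong (M (suc r)) j↦c)))))

  updateAt-split : ∀ {n} (v : Fin n → Carrier) i b →
    v b ≈ updateAt v i (λ _ → 0#) b + updateAt (λ _ → 0#) i (λ _ → v i) b
  updateAt-split v i b with b ≟ i
  ... | yes ≡.refl = sym (trans
    (+-cong (reflexive (updateAt-updates i v)) (reflexive (updateAt-updates i _))) (+-identityˡ _))
  ... | no b≢i    = sym (trans
    (+-cong (reflexive (updateAt-minimal b i v b≢i)) (reflexive (updateAt-minimal b i _ b≢i))) (+-identityʳ _))

  replaceRow : ∀ {n} → Matrix n → Fin n → (Fin n → Carrier) → Matrix n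
  replaceRow M r u = updateAt M r (λ _ → u)

  replaceRow-≡ : ∀ {n} (M : Matrix n) r u b → replaceRow M r u r b ≡ u b
  replaceRow-≡ M r u b = ≡.cong-app (updateAt-updates r M) b

  replaceRow-≢ : ∀ {n} (M : Matrix n) r u {a} b → a ≢ r → replaceRow M r u a b ≡ M a b
  replaceRow-≢ M r u b a≢r = ≡.cong-app (updateAt-minimal _ r M a≢r) b

  infixr 7 _·ᵥ_
  _·ᵥ_ : ∀ {n} → Matrix n → (Fin n → Carrier) → Fin n → Carrier
  _·ᵥ_ {n} M v a = ∑ n (λ b → M a b * v b)

  ·ᵥ-cong : ∀ {n} (M : Matrix n) {v w} → (∀ b → v b ≈ w b) → ∀ a → (M ·ᵥ v) a ≈ (M ·ᵥ w) a
  ·ᵥ-cong {n} M v≈w a = ∑-cong n (λ b → *-congˡ (v≈w b))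

  LinearlyIndependent : ∀ {n k} → (Fin k → Fin n → Carrier) → Set (c ⊔ ℓ)
  LinearlyIndependent {n} {k} v =
    ∀ (γ : Fin k → Carrier) → (∀ b → ∑ k (λ l → γ l * v l b) ≈ 0#) → ∀ l → γ l ≈ 0#

  KernelFamily : ∀ {n} → Matrix n → ℕ → Set (c ⊔ ℓ)
  KernelFamily {n} M k =
    Σ (Fin k → Fin n → Carrier) λ v → (∀ l a → (M ·ᵥ v l) a ≈ 0#) × LinearlyIndependent v

  independent-byCoordinates : ∀ {n n′ k} (u : Fin k → Fin n → Carrier) (v : Fin k → Fin n′ → Carrier) →
    (∀ b′ → Σ (Fin n) λ b → Σ Carrier λ x → ∀ l → v l b′ ≈ x * u l b) →
    LinearlyIndependent v → LinearlyIndependent u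
  independent-byCoordinates {k = k} u v coordinates v-indep γ u-comb≈0 = v-indep γ λ b′ →
    let (b , x , v≈xu) = coordinates b′ in begin
      ∑ k (λ l → γ l * v l b′)        ≈⟨ ∑-cong k (λ l → trans (*-congˡ (v≈xu l)) (*-leftComm _ x _)) ⟩
      ∑ k (λ l → x * (γ l * u l b))   ≈⟨ *-∑ k x _ ⟨
      x * ∑ k (λ l → γ l * u l b)     ≈⟨ trans (*-congˡ (u-comb≈0 b)) (zeroʳ x) ⟩
      0#                              ∎

  -- M′ is the Schur complement of the unit pivot M i i: since row and column i vanish off
  -- i and j = punchIn i j′, it differs from the minor of M at (i, i) only at (j′, j′).
  record IsPivotReduction {m} (M : Matrix (suc (suc m))) (M′ : Matrix (suc m))
                          (i : Fin (suc (suc m))) (j′ : Fin (suc m)) : Set ℓ where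
    field
      pivot      : M i i ≈ 1#
      row-sparse : ∀ k → k ≢ i → k ≢ punchIn i j′ → M i k ≈ 0#
      col-sparse : ∀ k → k ≢ i → k ≢ punchIn i j′ → M k i ≈ 0#
      minor-≈    : ∀ a b → (a ≡ j′ → b ≢ j′) → M′ a b ≈ M (punchIn i a) (punchIn i b)
      corner-≈   : M′ j′ j′ ≈ M (punchIn i j′) (punchIn i j′) - M i (punchIn i j′) * M (punchIn i j′) i

  module _ {m} {M : Matrix (suc (suc m))} {M′ : Matrix (suc m)} {i j′}
           (reduction : IsPivotReduction M M′ i j′) where
    open IsPivotReduction reduction

    private
      j : Fin (suc (suc m))
      j = punchIn i j′

      i≢j : i ≢ j
      i≢j i≡j = punchInᵢ≢i i j′ (≡.sym i≡j)

      i′ : Fin (suc m)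
      i′ = punchOut (i≢j ∘ ≡.sym)

      j↦i : punchIn j i′ ≡ i
      j↦i = punchIn-punchOut _

      Q : Matrix (suc m)
      Q = minor M i i

      X : Carrier
      X = det m (minor Q j′ j′)

      rowWithout-i rowOnly-i : Fin (suc (suc m)) → Carrier
      rowWithout-i = updateAt (M j) i (λ _ → 0#)
      rowOnly-i    = updateAt (λ _ → 0#) i (λ _ → M j i)

      N B : Matrix (suc (suc m))
      N = replaceRow M j rowWithout-i
      B = replaceRow M j rowOnly-i

      cornerRow : Fin (suc m) → Carrier
      cornerRow = updateAt (λ _ → 0#) j′ (λ _ → - (M i j * M j i))

      Q″ : Matrix (suc m)
      Q″ = replaceRow Q j′ cornerRow

      det-M≈N+B : det (suc (suc m)) M ≈ det (suc (suc m)) N + det (suc (suc m)) B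
      det-M≈N+B = det-linear (suc (suc m)) M N B j
        (λ a b a≢j → reflexive (replaceRow-≢ M j rowWithout-i b a≢j)
                   , reflexive (replaceRow-≢ M j rowOnly-i b a≢j))
        (λ b → trans (updateAt-split (M j) i b)
          (sym (+-cong (reflexive (replaceRow-≡ M j rowWithout-i b)) (reflexive (replaceRow-≡ M j rowOnly-i b)))))

      N-offColumn : ∀ a b → b ≢ i → N a b ≡ M a b
      N-offColumn a b b≢i with a ≟ j
      ... | yes ≡.refl = ≡.trans (replaceRow-≡ M j rowWithout-i b) (updateAt-minimal b i (M j) b≢i)
      ... | no a≢j    = replaceRow-≢ M j rowWithout-i b a≢j

      det-N : det (suc (suc m)) N ≈ det (suc m) Q
      det-N = begin
        det (suc (suc m)) N
          ≈⟨ det-expandCol (suc m) N i i column-i≈0 ⟩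
        signed (toℕ i ℕ.+ toℕ i) (N i i * det (suc m) (minor N i i))
          ≈⟨ signed-double (toℕ i) _ ⟩
        N i i * det (suc m) (minor N i i)
          ≈⟨ *-cong (trans (reflexive (replaceRow-≢ M j rowWithout-i i i≢j)) pivot)
                    (det-cong (suc m) λ a b → reflexive (N-offColumn (punchIn i a) _ (punchInᵢ≢i i b))) ⟩
        1# * det (suc m) Q
          ≈⟨ *-identityˡ _ ⟩
        det (suc m) Q ∎
        where
        column-i≈0 : ∀ a → a ≢ i → N a i ≈ 0#
        column-i≈0 a a≢i with a ≟ j
        ... | yes ≡.refl = reflexive (≡.trans (replaceRow-≡ M j rowWithout-i i) (updateAt-updates i (M j)))
        ... | no a≢j    = trans (reflexive (replaceRow-≢ M j rowWithout-i i a≢j)) (col-sparse a a≢i a≢j)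

      det-B : det (suc (suc m)) B ≈ - (M i j * (M j i * X))
      det-B = begin
        det (suc (suc m)) B
          ≈⟨ det-expandRow (suc m) B j i row-j≈0 ⟩
        signed (toℕ j ℕ.+ toℕ i) (B j i * det (suc m) (minor B j i))
          ≈⟨ signed-cong (toℕ j ℕ.+ toℕ i)
               (*-cong (reflexive (≡.trans (replaceRow-≡ M j rowOnly-i i) (updateAt-updates i _))) det-minor) ⟩
        signed (toℕ j ℕ.+ toℕ i) (M j i * signed (toℕ i′ ℕ.+ toℕ j′) (M i j * X))
          ≈⟨ signed-swap (toℕ j ℕ.+ toℕ i) (toℕ i′ ℕ.+ toℕ j′) 1 0 (suc (toℕ j′ ℕ.+ toℕ i′))
               (exchange-odd (toℕ j′) (toℕ i′) (toℕ-punchIn-exchange j i j′ i′ ≡.refl j↦i)) ⟩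
        - (M i j * (M j i * X)) ∎
        where
        row-j≈0 : ∀ b → b ≢ i → B j b ≈ 0#
        row-j≈0 b b≢i = reflexive (≡.trans (replaceRow-≡ M j rowOnly-i b) (updateAt-minimal b i _ b≢i))
        row-i≈0 : ∀ b → b ≢ j′ → minor M j i i′ b ≈ 0#
        row-i≈0 b b≢j′ = trans (reflexive (cong (λ r → M r (punchIn i b)) j↦i))
          (row-sparse (punchIn i b) (punchInᵢ≢i i b) (b≢j′ ∘ punchIn-injective i b j′))
        det-minor : det (suc m) (minor B j i) ≈ signed (toℕ i′ ℕ.+ toℕ j′) (M i j * X)
        det-minor = begin
          det (suc m) (minor B j i)
            ≈⟨ det-cong (suc m) (λ a b → reflexive (replaceRow-≢ M j rowOnly-i (punchIn i b) (punchInᵢ≢i j a))) ⟩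
          det (suc m) (minor M j i)
            ≈⟨ det-expandRow m (minor M j i) i′ j′ row-i≈0 ⟩
          signed (toℕ i′ ℕ.+ toℕ j′) (minor M j i i′ j′ * det m (minor (minor M j i) i′ j′))
            ≈⟨ signed-cong (toℕ i′ ℕ.+ toℕ j′) (*-cong (reflexive (cong (λ r → M r j) j↦i))
                 (det-cong m λ a b → reflexive (cong (λ r → M r (punchIn i (punchIn j′ b)))
                                                     (punchIn-exchange j i j′ i′ ≡.refl j↦i a)))) ⟩
          signed (toℕ i′ ℕ.+ toℕ j′) (M i j * X) ∎

      det-M′ : det (suc m) M′ ≈ det (suc m) Q + det (suc m) Q″
      det-M′ = det-linear (suc m) M′ Q Q″ j′ rows≈ row-j′
        where
        rows≈ : ∀ a b → a ≢ j′ → Q a b ≈ M′ a b × Q″ a b ≈ M′ a b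
        rows≈ a b a≢j′ = Q≈M′ , trans (reflexive (replaceRow-≢ Q j′ cornerRow b a≢j′)) Q≈M′
          where Q≈M′ = sym (minor-≈ a b (⊥-elim ∘ a≢j′))
        row-j′ : ∀ b → M′ j′ b ≈ Q j′ b + Q″ j′ b
        row-j′ b with b ≟ j′
        ... | yes ≡.refl = trans corner-≈
          (+-congˡ (sym (reflexive (≡.trans (replaceRow-≡ Q j′ cornerRow j′) (updateAt-updates j′ _)))))
        ... | no b≢j′    = trans (minor-≈ j′ b (λ _ → b≢j′)) (sym (trans (+-congˡ
          (reflexive (≡.trans (replaceRow-≡ Q j′ cornerRow b) (updateAt-minimal b j′ _ b≢j′)))) (+-identityʳ _)))

      det-Q″ : det (suc m) Q″ ≈ - (M i j * M j i) * X
      det-Q″ = begin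
        det (suc m) Q″
          ≈⟨ det-expandRow m Q″ j′ j′ (λ b b≢j′ →
               reflexive (≡.trans (replaceRow-≡ Q j′ cornerRow b) (updateAt-minimal b j′ _ b≢j′))) ⟩
        signed (toℕ j′ ℕ.+ toℕ j′) (Q″ j′ j′ * det m (minor Q″ j′ j′))
          ≈⟨ signed-double (toℕ j′) _ ⟩
        Q″ j′ j′ * det m (minor Q″ j′ j′)
          ≈⟨ *-cong (reflexive (≡.trans (replaceRow-≡ Q j′ cornerRow j′) (updateAt-updates j′ _)))
                    (det-cong m λ a b →
                      reflexive (replaceRow-≢ Q j′ cornerRow (punchIn j′ b) (punchInᵢ≢i j′ a))) ⟩
        - (M i j * M j i) * X ∎

    -- Row j of M is N's row j plus B's, which keeps only the entry M j i.  Expanding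
    -- det N along column i gives det Q; expanding det B along row j and then row i gives
    -- -M i j M j i X, which is also what the change of M′ at (j′, j′) contributes.
    det-pivotReduction : det (suc (suc m)) M ≈ det (suc m) M′
    det-pivotReduction = begin
      det (suc (suc m)) M                        ≈⟨ det-M≈N+B ⟩
      det (suc (suc m)) N + det (suc (suc m)) B  ≈⟨ +-cong det-N det-B ⟩
      det (suc m) Q + - (M i j * (M j i * X))
        ≈⟨ +-congˡ (trans (-‿cong (sym (*-assoc _ _ _))) (-‿distribˡ-* _ _)) ⟩
      det (suc m) Q + - (M i j * M j i) * X      ≈⟨ +-congˡ det-Q″ ⟨
      det (suc m) Q + det (suc m) Q″             ≈⟨ det-M′ ⟨
      det (suc m) M′                             ∎

    restrict : (Fin (suc (suc m)) → Carrier) → Fin (suc m) → Carrier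
    restrict v = v ∘ punchIn i

    ·ᵥ-pivotRow : ∀ v → (M ·ᵥ v) i ≈ v i + M i j * v j
    ·ᵥ-pivotRow v = begin
      (M ·ᵥ v) i                                          ≈⟨ ∑-punchIn (suc m) (λ b → M i b * v b) i ⟩
      M i i * v i + ∑ (suc m) (λ b → M i (punchIn i b) * restrict v b)
        ≈⟨ +-cong (trans (*-congʳ pivot) (*-identityˡ _))
                  (∑-single m (λ b → M i (punchIn i b) * restrict v b) j′ off-j≈0) ⟩
      v i + M i j * v j                                   ∎
      where
      off-j≈0 : ∀ b → b ≢ j′ → M i (punchIn i b) * restrict v b ≈ 0#
      off-j≈0 b b≢j′ =
        trans (*-congʳ (row-sparse _ (punchInᵢ≢i i b) (b≢j′ ∘ punchIn-injective i b j′))) (zeroˡ _)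

    ·ᵥ-punchIn : ∀ v a → a ≢ j′ → (M ·ᵥ v) (punchIn i a) ≈ (M′ ·ᵥ restrict v) a
    ·ᵥ-punchIn v a a≢j′ = begin
      (M ·ᵥ v) (punchIn i a)
        ≈⟨ ∑-punchIn (suc m) (λ b → M (punchIn i a) b * v b) i ⟩
      M (punchIn i a) i * v i + ∑ (suc m) (λ b → M (punchIn i a) (punchIn i b) * restrict v b)
        ≈⟨ +-cong (trans (*-congʳ (col-sparse _ (punchInᵢ≢i i a) (a≢j′ ∘ punchIn-injective i a j′))) (zeroˡ _))
                  (∑-cong (suc m) λ b → *-congʳ {restrict v b} (sym (minor-≈ a b (⊥-elim ∘ a≢j′)))) ⟩
      0# + (M′ ·ᵥ restrict v) a
        ≈⟨ +-identityˡ _ ⟩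
      (M′ ·ᵥ restrict v) a ∎

    ·ᵥ-neighbourRow : ∀ v → (M ·ᵥ v) j ≈ (M′ ·ᵥ restrict v) j′ + M j i * (M ·ᵥ v) i
    ·ᵥ-neighbourRow v = begin
      (M ·ᵥ v) j
        ≈⟨ trans (∑-punchIn (suc m) (λ b → M j b * v b) i)
                 (+-congˡ (∑-punchIn m (λ b → M j (punchIn i b) * restrict v b) j′)) ⟩
      M j i * v i + (M j j * v j + rest)
        ≈⟨ x+[y+z]≈[y-w+z]+[x+w] _ _ _ _ ⟩
      (M j j * v j - (M i j * M j i) * v j + rest) + (M j i * v i + (M i j * M j i) * v j)
        ≈⟨ +-cong (+-cong corner rest≈) (+-congˡ (trans (*-assoc _ _ _) (*-leftComm _ _ _))) ⟩
      (M′ j′ j′ * v j + ∑ m (λ b → M′ j′ (punchIn j′ b) * restrict v (punchIn j′ b)))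
        + (M j i * v i + M j i * (M i j * v j))
        ≈⟨ +-cong (sym (∑-punchIn m (λ b → M′ j′ b * restrict v b) j′)) (sym (distribˡ _ _ _)) ⟩
      (M′ ·ᵥ restrict v) j′ + M j i * (v i + M i j * v j)
        ≈⟨ +-congˡ (*-congˡ (sym (·ᵥ-pivotRow v))) ⟩
      (M′ ·ᵥ restrict v) j′ + M j i * (M ·ᵥ v) i ∎
      where
      rest : Carrier
      rest = ∑ m (λ b → M j (punchIn i (punchIn j′ b)) * v (punchIn i (punchIn j′ b)))
      rest≈ : rest ≈ ∑ m (λ b → M′ j′ (punchIn j′ b) * restrict v (punchIn j′ b))
      rest≈ = ∑-cong m λ b → *-congʳ (sym (minor-≈ j′ (punchIn j′ b) λ _ → punchInᵢ≢i j′ b))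
      corner : M j j * v j - (M i j * M j i) * v j ≈ M′ j′ j′ * v j
      corner = sym (trans (*-congʳ corner-≈) (trans (distribʳ (v j) _ _) (+-congˡ (sym (-‿distribˡ-* _ _)))))

    private
      pivotEntry : ∀ {v} → (M ·ᵥ v) i ≈ 0# → v i ≈ - M i j * v j
      pivotEntry {v} Mvᵢ≈0 =
        trans (+-inverseˡ-unique (v i) _ (trans (sym (·ᵥ-pivotRow v)) Mvᵢ≈0)) (-‿distribˡ-* _ _)

      extend : (Fin (suc m) → Carrier) → Fin (suc (suc m)) → Carrier
      extend w a with a ≟ i
      ... | yes _   = - M i j * w j′
      ... | no a≢i  = w (punchOut (a≢i ∘ ≡.sym))

      extend-i : ∀ w → extend w i ≈ - M i j * w j′
      extend-i w with i ≟ i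
      ... | yes _   = refl
      ... | no i≢i  = ⊥-elim (i≢i ≡.refl)

      extend-punchIn : ∀ w b → extend w (punchIn i b) ≈ w b
      extend-punchIn w b with punchIn i b ≟ i
      ... | yes i≡i = ⊥-elim (punchInᵢ≢i i b i≡i)
      ... | no _    = reflexive (cong w (punchIn-injective i _ b (punchIn-punchOut _)))

    kernelFamily-⇔ : ∀ k → KernelFamily M k ⇔ KernelFamily M′ k
    kernelFamily-⇔ k = mk⇔ to from
      where
      to : KernelFamily M k → KernelFamily M′ k
      to (v , v∈ker , v-indep) = (λ l → restrict (v l)) , w∈ker , independent-byCoordinates _ v coordinates v-indep
        where
        w∈ker : ∀ l a → (M′ ·ᵥ restrict (v l)) a ≈ 0#
        w∈ker l a with a ≟ j′
        ... | yes ≡.refl = trans (sym (trans (+-congˡ (trans (*-congˡ (v∈ker l i)) (zeroʳ _))) (+-identityʳ _)))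
                                 (trans (sym (·ᵥ-neighbourRow (v l))) (v∈ker l j))
        ... | no a≢j′    = trans (sym (·ᵥ-punchIn (v l) a a≢j′)) (v∈ker l (punchIn i a))
        coordinates : ∀ b′ → Σ (Fin (suc m)) λ b → Σ Carrier λ x → ∀ l → v l b′ ≈ x * restrict (v l) b
        coordinates b′ with b′ ≟ i
        ... | yes ≡.refl = j′ , - M i j , λ l → pivotEntry {v l} (v∈ker l i)
        ... | no b′≢i    = punchOut (b′≢i ∘ ≡.sym) , 1# , λ l →
          trans (reflexive (cong (v l) (≡.sym (punchIn-punchOut _)))) (sym (*-identityˡ _))

      from : KernelFamily M′ k → KernelFamily M k
      from (w , w∈ker , w-indep) = (λ l → extend (w l)) , v∈ker , independent-byCoordinates _ w coordinates w-indep
        where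
        pivotRow≈0 : ∀ l → (M ·ᵥ extend (w l)) i ≈ 0#
        pivotRow≈0 l = begin
          (M ·ᵥ extend (w l)) i                          ≈⟨ ·ᵥ-pivotRow (extend (w l)) ⟩
          extend (w l) i + M i j * extend (w l) j
            ≈⟨ +-cong (extend-i (w l)) (*-congˡ (extend-punchIn (w l) j′)) ⟩
          - M i j * w l j′ + M i j * w l j′              ≈⟨ +-congʳ (-‿distribˡ-* _ _) ⟨
          - (M i j * w l j′) + M i j * w l j′            ≈⟨ -‿inverseˡ _ ⟩
          0#                                             ∎
        restriction≈0 : ∀ l a → (M′ ·ᵥ restrict (extend (w l))) a ≈ 0#
        restriction≈0 l a = trans (·ᵥ-cong M′ (extend-punchIn (w l)) a) (w∈ker l a)
        punchIn-row≈0 : ∀ l a → (M ·ᵥ extend (w l)) (punchIn i a) ≈ 0#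
        punchIn-row≈0 l a with a ≟ j′
        ... | yes ≡.refl = trans (·ᵥ-neighbourRow (extend (w l)))
                                 (+-pres-≈0 (restriction≈0 l j′) (trans (*-congˡ (pivotRow≈0 l)) (zeroʳ _)))
        ... | no a≢j′    = trans (·ᵥ-punchIn (extend (w l)) a a≢j′) (restriction≈0 l a)
        v∈ker : ∀ l a′ → (M ·ᵥ extend (w l)) a′ ≈ 0#
        v∈ker l a′ with a′ ≟ i
        ... | yes ≡.refl = pivotRow≈0 l
        ... | no a′≢i    = trans
          (reflexive (cong (M ·ᵥ extend (w l)) (≡.sym (punchIn-punchOut (a′≢i ∘ ≡.sym)))))
          (punchIn-row≈0 l _)
        coordinates : ∀ b → Σ (Fin (suc (suc m))) λ b′ → Σ Carrier λ x → ∀ l → w l b ≈ x * extend (w l) b′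
        coordinates b = punchIn i b , 1# , λ l → sym (trans (*-identityˡ _) (extend-punchIn (w l) b))


module DeformedLaplacian {c ℓ} (K : CommutativeRing c ℓ) where
  open Laplacian K
  open PolynomialRing K
  open RingProperties K
  module Poly   = Determinant K K[t]
  module Scalar = Determinant K K

  sumFin≡∑ : ∀ n f → sumFin n f ≡ Scalar.∑ n f
  sumFin≡∑ zero    f = ≡.refl
  sumFin≡∑ (suc n) f = cong (f zero +_) (sumFin≡∑ n (λ k → f (suc k)))

  -- Stated for a variable n: at a concrete size, conversion checking would unfold both sides.
  charPoly≡det : ∀ {n} (A : Adj n) → charPoly A ≡ Poly.det n (deformedLaplacian A)
  charPoly≡det A = ≡.refl

  reciprocalDegree : ∀ {n} → Adj n → Fin n → Carrier
  reciprocalDegree {n} A a = sumFin n (λ k → ⟦ A a k ∧ A k a ⟧)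

  -t : Poly
  -t = 0# ∷ - 1# ∷ []

  diagonalEntry : Carrier → Poly
  diagonalEntry d = 1# ∷ 0# ∷ (d - 1#) ∷ []

  module _ {n} (A : Adj n) where
    private
      L = deformedLaplacian A

    deformedLaplacian-nonEdge : ∀ a b → a ≢ b → A a b ≡ false → L a b ≈ₚ 0ₚ
    deformedLaplacian-nonEdge a b a≢b Aab rewrite dec-false (a ≟ b) a≢b | Aab =
      refl , -0#≈0# , -‿inverseʳ 0# , -‿inverseʳ 0# , _

    deformedLaplacian-reciprocalEdge : ∀ a b → a ≢ b → A a b ≡ true → A b a ≡ true → L a b ≈ₚ -t
    deformedLaplacian-reciprocalEdge a b a≢b Aab Aba rewrite dec-false (a ≟ b) a≢b | Aab | Aba =
      refl , refl , -‿inverseʳ 0# , -‿inverseʳ 1# , _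

    deformedLaplacian-diagonal : ∀ a → A a a ≡ false → L a a ≈ₚ diagonalEntry (reciprocalDegree A a)
    deformedLaplacian-diagonal a Aaa rewrite dec-true (a ≟ a) ≡.refl | Aaa =
      refl , -0#≈0# , refl , -‿inverseʳ 0# , _

  reciprocalDegree-removeVertex : ∀ {n} (A : Adj (suc n)) i a →
    reciprocalDegree A (punchIn i a)
      ≈ ⟦ A (punchIn i a) i ∧ A i (punchIn i a) ⟧ + reciprocalDegree (removeVertex A i) a
  reciprocalDegree-removeVertex {n} A i a = begin
    sumFin (suc n) edge                       ≡⟨ sumFin≡∑ (suc n) edge ⟩
    Scalar.∑ (suc n) edge                     ≈⟨ Scalar.∑-punchIn n edge i ⟩
    edge i + Scalar.∑ n (edge ∘ punchIn i)    ≡⟨ cong (edge i +_) (sumFin≡∑ n (edge ∘ punchIn i)) ⟨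
    edge i + sumFin n (edge ∘ punchIn i)      ∎
    where
    edge : Fin (suc n) → Carrier
    edge k = ⟦ A (punchIn i a) k ∧ A k (punchIn i a) ⟧

  does-punchIn : ∀ {n} (i : Fin (suc n)) a b → does (punchIn i a ≟ punchIn i b) ≡ does (a ≟ b)
  does-punchIn i a b with a ≟ b
  ... | yes ≡.refl = dec-true (punchIn i a ≟ punchIn i a) ≡.refl
  ... | no a≢b    = dec-false (punchIn i a ≟ punchIn i b) (a≢b ∘ punchIn-injective i a b)

  deformedLaplacian-removeVertex : ∀ {n} (A : Adj (suc n)) i a b →
    (a ≡ b → reciprocalDegree (removeVertex A i) a ≈ reciprocalDegree A (punchIn i a)) →
    deformedLaplacian (removeVertex A i) a b ≈ₚ deformedLaplacian A (punchIn i a) (punchIn i b)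
  deformedLaplacian-removeVertex A i a b degree≈
    rewrite does-punchIn i a b with a ≟ b
  ... | yes ≡.refl = refl , refl , +-congʳ (degree≈ ≡.refl) , refl , _
  ... | no _       = refl , refl , refl , refl , _

  t² : Poly
  t² = 0# ∷ 0# ∷ 1# ∷ []

  -t*-t≋t² : (-t *ₚ -t) ≋ t²
  -t*-t≋t² = ≈ₚ⇒≋ _ _
    ( trans (+-identityʳ _) (zeroˡ 0#)
    , trans (+-congˡ (trans (+-identityʳ _) (zeroʳ _))) (trans (+-identityʳ _) (zeroˡ _))
    , trans (-x*-y≈x*y 1# 1#) (*-identityˡ 1#)
    , _ )

  diagonalEntry-+1 : ∀ d → (diagonalEntry (1# + d) +ₚ (-ₚ (-t *ₚ -t))) ≋ diagonalEntry d
  diagonalEntry-+1 d = ≋-trans (+ₚ-cong (≋-refl {diagonalEntry (1# + d)}) (-ₚ-cong -t*-t≋t²)) (≈ₚ⇒≋ _ _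
    ( trans (+-congˡ -0#≈0#) (+-identityʳ 1#)
    , trans (+-congˡ -0#≈0#) (+-identityʳ 0#)
    , +-congʳ 1+d-1≈d
    , _ ))
    where
    1+d-1≈d : (1# + d) - 1# ≈ d
    1+d-1≈d = trans (+-congʳ (+-comm 1# d))
      (trans (+-assoc d 1# (- 1#)) (trans (+-congˡ (-‿inverseʳ 1#)) (+-identityʳ d)))

  evalMatrix : ∀ {n} → Poly.Matrix n → Carrier → Scalar.Matrix n
  evalMatrix M x a b = eval (M a b) x

  eval-pivotReduction : ∀ {m} {M : Poly.Matrix (suc (suc m))} {M′ i j′} →
    Poly.IsPivotReduction M M′ i j′ → ∀ x → Scalar.IsPivotReduction (evalMatrix M x) (evalMatrix M′ x) i j′
  eval-pivotReduction {M = M} {i = i} {j′} reduction x = record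
    { pivot      = trans (eval-cong x pivot) (eval-1ₚ x)
    ; row-sparse = λ k k≢i k≢j → eval-cong x (row-sparse k k≢i k≢j)
    ; col-sparse = λ k k≢i k≢j → eval-cong x (col-sparse k k≢i k≢j)
    ; minor-≈    = λ a b a≡j′⇒b≢j′ → eval-cong x (minor-≈ a b a≡j′⇒b≢j′)
    ; corner-≈   = trans (eval-cong x corner-≈)
                     (trans (eval-+ₚ x (M j j) (-ₚ (M i j *ₚ M j i)))
                       (+-congˡ (trans (eval--ₚ x (M i j *ₚ M j i)) (-‿cong (eval-*ₚ x (M i j) (M j i))))))
    }
    where
    open Poly.IsPivotReduction reduction
    j = punchIn i j′

  indepKernelFamily⇔kernelFamily : ∀ {n} (A : Adj n) x k →
    IndepKernelFamily A x k ⇔ Scalar.KernelFamily (evalLaplacian A x) k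
  indepKernelFamily⇔kernelFamily {n} A x k = mk⇔
    (λ (v , v∈ker , v-indep) → v
       , (λ l a → trans (reflexive (≡.sym (sumFin≡∑ n _))) (v∈ker l a))
       , (λ γ comb≈0 → v-indep γ λ b → trans (reflexive (sumFin≡∑ k _)) (comb≈0 b)))
    (λ (v , v∈ker , v-indep) → v
       , (λ l a → trans (reflexive (sumFin≡∑ n _)) (v∈ker l a))
       , (λ γ comb≈0 → v-indep γ λ b → trans (reflexive (≡.sym (sumFin≡∑ k _))) (comb≈0 b)))

  module _ {n n′} (A : Adj n) (A′ : Adj n′) where
    isFiniteEigenvalue-⇔ : charPoly A ≈ₚ charPoly A′ → ∀ x → IsFiniteEigenvalue A x ⇔ IsFiniteEigenvalue A′ x
    isFiniteEigenvalue-⇔ p≈p′ x = mk⇔ (trans (sym (eval-cong x p≋p′))) (trans (eval-cong x p≋p′))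
      where
      p≋p′ = ≈ₚ⇒≋ _ _ p≈p′

    algMult-⇔ : charPoly A ≈ₚ charPoly A′ → ∀ x m → AlgMult A x m ⇔ AlgMult A′ x m
    algMult-⇔ p≈p′ x m = mk⇔
      (λ (divides , ¬divides) → ∣ₚ-respʳ ((t- x) ^ₚ m) p≈p′ divides
                              , ¬divides ∘ ∣ₚ-respʳ ((t- x) ^ₚ suc m) p′≈p)
      (λ (divides , ¬divides) → ∣ₚ-respʳ ((t- x) ^ₚ m) p′≈p divides
                              , ¬divides ∘ ∣ₚ-respʳ ((t- x) ^ₚ suc m) p≈p′)
      where
      p′≈p = ≈ₚ-sym _ _ p≈p′

    geomMult-⇔ : ∀ x → (∀ k → IndepKernelFamily A x k ⇔ IndepKernelFamily A′ x k) →
      ∀ m → GeomMult A x m ⇔ GeomMult A′ x m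
    geomMult-⇔ x families⇔ m = mk⇔
      (λ (family , ¬family) → to (families⇔ m) family , ¬family ∘ from (families⇔ (suc m)))
      (λ (family , ¬family) → from (families⇔ m) family , ¬family ∘ to (families⇔ (suc m)))
      where open Equivalence

ReciprocalNeighbour : ∀ {n} → Adj n → Fin n → Fin n → Set
ReciprocalNeighbour A i j =
  (A i j ≡ true) × (A j i ≡ true) × (∀ k → k ≢ j → (A i k ≡ false) × (A k i ≡ false))

reciprocalLeaf⇒neighbour : ∀ {n} (A : Adj (suc n)) {i} → ReciprocalLeaf A i →
  Σ (Fin n) λ j′ → ReciprocalNeighbour A i (punchIn i j′)
reciprocalLeaf⇒neighbour A {i} (j , j≢i , neighbour) =
  punchOut (j≢i ∘ ≡.sym) , ≡.subst (ReciprocalNeighbour A i) (≡.sym (punchIn-punchOut _)) neighbour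

module LeafRemoval {c ℓ} (K : CommutativeRing c ℓ) {m} (A : Adj (suc (suc m))) (loopless : Loopless A)
                   (i : Fin (suc (suc m))) (j′ : Fin (suc m))
                   (neighbour : ReciprocalNeighbour A i (punchIn i j′)) where
  open Laplacian K
  open PolynomialRing K
  open RingProperties K
  open DeformedLaplacian K

  private
    j : Fin (suc (suc m))
    j = punchIn i j′

    Ã : Adj (suc m)
    Ã = removeVertex A i

    L : Poly.Matrix (suc (suc m))
    L = deformedLaplacian A

    L̃ : Poly.Matrix (suc m)
    L̃ = deformedLaplacian Ã

    edge-ij : A i j ≡ true
    edge-ij = proj₁ neighbour

    edge-ji : A j i ≡ true
    edge-ji = proj₁ (proj₂ neighbour)

    isolated : ∀ k → k ≢ j → (A i k ≡ false) × (A k i ≡ false)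
    isolated = proj₂ (proj₂ neighbour)

    i≢j : i ≢ j
    i≢j = punchInᵢ≢i i j′ ∘ ≡.sym

    degree-i : reciprocalDegree A i ≈ 1#
    degree-i = begin
      reciprocalDegree A i       ≡⟨ sumFin≡∑ (suc (suc m)) edge ⟩
      Scalar.∑ (suc (suc m)) edge
        ≈⟨ Scalar.∑-single (suc m) edge j
             (λ k k≢j → reflexive (cong (λ b → ⟦ b ∧ A k i ⟧) (proj₁ (isolated k k≢j)))) ⟩
      ⟦ A i j ∧ A j i ⟧          ≡⟨ ≡.cong₂ (λ u v → ⟦ u ∧ v ⟧) edge-ij edge-ji ⟩
      1#                         ∎
      where
      edge : Fin (suc (suc m)) → Carrier
      edge k = ⟦ A i k ∧ A k i ⟧

    degree-punchIn : ∀ a → a ≢ j′ → reciprocalDegree Ã a ≈ reciprocalDegree A (punchIn i a)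
    degree-punchIn a a≢j′ =
      sym (trans (reciprocalDegree-removeVertex A i a) (trans (+-congʳ edge≈0) (+-identityˡ _)))
      where
      edge≈0 : ⟦ A (punchIn i a) i ∧ A i (punchIn i a) ⟧ ≈ 0#
      edge≈0 = reflexive (cong ⟦_⟧ (≡.trans (cong (A (punchIn i a) i ∧_)
        (proj₁ (isolated (punchIn i a) (a≢j′ ∘ punchIn-injective i a j′)))) (∧-zeroʳ _)))

    degree-j : reciprocalDegree A j ≈ 1# + reciprocalDegree Ã j′
    degree-j = trans (reciprocalDegree-removeVertex A i j′)
      (+-congʳ (reflexive (≡.cong₂ (λ u v → ⟦ u ∧ v ⟧) edge-ji edge-ij)))

    L-ij : L i j ≋ -t
    L-ij = ≈ₚ⇒≋ _ _ (deformedLaplacian-reciprocalEdge A i j i≢j edge-ij edge-ji)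

    L-ji : L j i ≋ -t
    L-ji = ≈ₚ⇒≋ _ _ (deformedLaplacian-reciprocalEdge A j i (i≢j ∘ ≡.sym) edge-ji edge-ij)

    pivot : L i i ≋ 1ₚ
    pivot = ≈ₚ⇒≋ (L i i) 1ₚ (≈ₚ-trans (L i i) (diagonalEntry (reciprocalDegree A i)) 1ₚ
      (deformedLaplacian-diagonal A i (loopless i)) (refl , refl , x≈y⇒x∙y⁻¹≈ε degree-i , _))

    corner : L̃ j′ j′ ≋ (L j j +ₚ (-ₚ (L i j *ₚ L j i)))
    corner = ≋-sym (≋-trans (+ₚ-cong L-jj (-ₚ-cong (≋-trans (*ₚ-congˡ (L j i) L-ij) (*ₚ-congʳ -t L-ji))))
      (≋-trans (diagonalEntry-+1 (reciprocalDegree Ã j′)) (≋-sym L̃-j′j′)))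
      where
      L-jj : L j j ≋ diagonalEntry (1# + reciprocalDegree Ã j′)
      L-jj = ≋-trans (≈ₚ⇒≋ (L j j) _ (deformedLaplacian-diagonal A j (loopless j)))
        (≈ₚ⇒≋ (diagonalEntry (reciprocalDegree A j)) _ (refl , refl , +-congʳ degree-j , _))
      L̃-j′j′ : L̃ j′ j′ ≋ diagonalEntry (reciprocalDegree Ã j′)
      L̃-j′j′ = ≈ₚ⇒≋ _ _ (deformedLaplacian-diagonal Ã j′ (loopless j))

    reduction : Poly.IsPivotReduction L L̃ i j′
    reduction = record
      { pivot      = pivot
      ; row-sparse = λ k k≢i k≢j → ≈ₚ⇒≋ _ _
          (deformedLaplacian-nonEdge A i k (k≢i ∘ ≡.sym) (proj₁ (isolated k k≢j)))
      ; col-sparse = λ k k≢i k≢j → ≈ₚ⇒≋ _ _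
          (deformedLaplacian-nonEdge A k i k≢i (proj₂ (isolated k k≢j)))
      ; minor-≈    = λ a b a≡j′⇒b≢j′ → ≈ₚ⇒≋ _ _ (deformedLaplacian-removeVertex A i a b
          λ { ≡.refl → degree-punchIn a λ a≡j′ → a≡j′⇒b≢j′ a≡j′ a≡j′ })
      ; corner-≈   = corner
      }

  charPoly-≈ₚ : charPoly A ≈ₚ charPoly Ã
  charPoly-≈ₚ = ≡.subst₂ _≈ₚ_ (≡.sym (charPoly≡det A)) (≡.sym (charPoly≡det Ã))
    (≋⇒≈ₚ _ _ (Poly.det-pivotReduction reduction))

  indepKernelFamily-⇔ : ∀ x k → IndepKernelFamily A x k ⇔ IndepKernelFamily Ã x k
  indepKernelFamily-⇔ x k =
    ⇔-sym (indepKernelFamily⇔kernelFamily Ã x k)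
      ⇔-∘ (Scalar.kernelFamily-⇔ (eval-pivotReduction reduction x) k
      ⇔-∘ indepKernelFamily⇔kernelFamily A x k)

theorem3p12 : ∀ {c ℓ} (K : CommutativeRing c ℓ) → IsField K →
    ∀ (n : ℕ) (A : Adj (suc n)) → Loopless A →
    (i : Fin (suc n)) → ReciprocalLeaf A i →
      (∀ x → Laplacian.IsFiniteEigenvalue K A x ⇔ Laplacian.IsFiniteEigenvalue K (removeVertex A i) x)
    × (∀ x m → Laplacian.AlgMult K A x m ⇔ Laplacian.AlgMult K (removeVertex A i) x m)
    × (∀ x m → Laplacian.GeomMult K A x m ⇔ Laplacian.GeomMult K (removeVertex A i) x m)
theorem3p12 K _ zero    A loopless i leaf = ⊥-elim (¬Fin0 (proj₁ (reciprocalLeaf⇒neighbour A leaf)))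
theorem3p12 K _ (suc m) A loopless i leaf =
    isFiniteEigenvalue-⇔ A (removeVertex A i) charPoly-≈ₚ
  , algMult-⇔ A (removeVertex A i) charPoly-≈ₚ
  , λ x → geomMult-⇔ A (removeVertex A i) x (indepKernelFamily-⇔ x)
  where
  open DeformedLaplacian K
  neighbour = reciprocalLeaf⇒neighbour A leaf
  open LeafRemoval K A loopless i (proj₁ neighbour) (proj₂ neighbour)
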